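{- Let $\Sigma$ be a set, $\Sigma_\tau=\Sigma+\{\tau\}$, $1=\{\checkmark\}$, and $F_\tau=\Sigma_\tau\times\mathcal{I}d+1$. The monad $\overline{F_\tau}$ on the Kleisli category $\mathcal{K}l(\mathcal{P})$ described in the context is an ordered saturation monad (on the base category $\mathcal{K}l(\mathcal{P})$).
   Context: $\mathcal{K}l(\mathcal{P})$ has sets as objects and maps $X\to\mathcal{P}Y$ (relations) as morphisms, with relational composition. The monad $\overline{F_\tau}$ on $\mathcal{K}l(\mathcal{P})$ is determined by its Kleisli category: morphisms $X\rightsquigarrow Y$ are maps $f:X\to\mathcal{P}(\Sigma_\tau\times Y+1)$, identities $x\mapsto\{(\tau,x)\}$, composition $g\bullet f(x)=\{(\sigma,z)\mid\exists y:\ ((\sigma,y)\in f(x),(\tau,z)\in g(y))\text{ or }((\tau,y)\in f(x),(\sigma,z)\in g(y))\}\cup\{\checkmark\mid\checkmark\in f(x)\text{ or }\exists y:(\tau,y)\in f(x),\checkmark\in g(y)\}$; a morphism $r:X\to\mathcal{P}Y$ of the base category $\mathcal{K}l(\mathcal{P})$ induces $r^\sharp:x\mapsto\{(\tau,y)\mid y\in r(x)\}$; hom-sets are ordered pointwise by inclusion. Ordered saturation monad on a base category $\mathsf{B}$ (with Kleisli composition $\bullet$, identities $1$, induced morphisms $r^\sharp$): Kleisli hom-sets are posets with monotone composition and for each $\alpha:X\rightsquigarrow X$ there is $\alpha^*$ with (1) $1\le\alpha^*$; (2) $\alpha\le\alpha^*$; (3) $\alpha^*\bullet\alpha^*\le\alpha^*$;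 (4) $\alpha^*\le\beta$ whenever $1\le\beta$, $\alpha\le\beta$, $\beta\bullet\beta\le\beta$; (5) for every morphism $r:X\to Y$ of $\mathsf{B}$ and $\beta:Y\rightsquigarrow Y$, $r^\sharp\bullet\alpha\le\beta\bullet r^\sharp\Rightarrow r^\sharp\bullet\alpha^*\le\beta^*\bullet r^\sharp$, and likewise with $\ge$. Here $\mathsf{B}=\mathcal{K}l(\mathcal{P})$, so (5) ranges over all relations $r:X\to\mathcal{P}Y$. -}

module Defs where

open import Level using (0ℓ)
open import Data.Unit using (⊤; tt)
open import Data.Empty using (⊥)
open import Data.Product using (Σ; _×_; _,_; ∃-syntax)
open import Data.Sum using (_⊎_; inj₁; inj₂)
open import Relation.Binary.PropositionalEquality using (_≡_)

data Label (A : Set) : Set where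
  act : A → Label A
  τ   : Label A

F : (A : Set) → Set → Set
F A Y = (Label A × Y) ⊎ ⊤

✓ : {A Y : Set} → F A Y
✓ = inj₂ tt

𝒫 : Set → Set₁
𝒫 Y = Y → Set

-- Morphisms X → Y of the base category Kl(𝒫): relations X → 𝒫 Y
BMor : Set → Set → Set₁
BMor X Y = X → 𝒫 Y

-- Kleisli morphisms X ⇝ Y of the lifted monad: X → 𝒫 (Σ_τ × Y + 1)
KMor : (A : Set) → Set → Set → Set₁
KMor A X Y = X → 𝒫 (F A Y)

idK : {A X : Set} → KMor A X X
idK x (inj₁ (σ , y)) = (σ ≡ τ) × (y ≡ x)
idK x (inj₂ _)       = ⊥

infixr 9 _•_
_•_ : {A X Y Z : Set} → KMor A Y Z → KMor A X Y → KMor A X Z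
_•_ {Y = Y} g f x (inj₁ (σ , z)) =
  ∃[ y ] ((f x (inj₁ (σ , y)) × g y (inj₁ (τ , z)))
         ⊎ (f x (inj₁ (τ , y)) × g y (inj₁ (σ , z))))
_•_ {Y = Y} g f x (inj₂ _) =
  f x ✓ ⊎ (∃[ y ] (f x (inj₁ (τ , y)) × g y ✓))

_♯ : {A X Y : Set} → BMor X Y → KMor A X Y
(r ♯) x (inj₁ (σ , y)) = (σ ≡ τ) × r x y
(r ♯) x (inj₂ _)       = ⊥

infix 4 _≤K_
_≤K_ : {A X Y : Set} → KMor A X Y → KMor A X Y → Set
α ≤K β = ∀ x e → α x e → β x e

-- Ordered saturation structure (conditions (1)–(5) plus monotone composition).
-- The hom-set order ≤K is a preorder by construction (a partial order up to
-- extensional equality of subsets).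
record OrderedSaturation (A : Set) : Set₁ where
  field
    •-mono : {X Y Z : Set} {f f′ : KMor A X Y} {g g′ : KMor A Y Z} →
             f ≤K f′ → g ≤K g′ → g • f ≤K g′ • f′
    _*     : {X : Set} → KMor A X X → KMor A X X
    sat-1  : {X : Set} (α : KMor A X X) → idK ≤K α *
    sat-2  : {X : Set} (α : KMor A X X) → α ≤K α *
    sat-3  : {X : Set} (α : KMor A X X) → (α *) • (α *) ≤K α *
    sat-4  : {X : Set} (α β : KMor A X X) →
             idK ≤K β → α ≤K β → β • β ≤K β → α * ≤K β
    sat-5≤ : {X Y : Set} (r : BMor X Y) (α : KMor A X X) (β : KMor A Y Y) →
             (r ♯) • α ≤K β • (r ♯) → (r ♯) • (α *) ≤K (β *) • (r ♯)
    sat-5≥ : {X Y : Set} (r : BMor X Y) (α : KMor A X X) (β : KMor A Y Y) →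
             β • (r ♯) ≤K (r ♯) • α → (β *) • (r ♯) ≤K (r ♯) • (α *)

-- The saturation α* is the weak transition relation of α: a run of silent τ-steps, possibly one
-- visible step (or a final ✓) surrounded by silent runs. Such runs compose, and
-- any β containing 1 and α and closed under • absorbs them, which gives (1)–(4).
-- For (5), composing with r♯ on either side just relabels states through r,
-- so each inequality of (5) is a one-step simulation condition between α and β;
-- it extends along τ-runs by induction, hence to weak transitions.
module Submission where

open import Defs
open import Data.Product using (_×_; _,_; ∃-syntax)
open import Data.Sum using (inj₁; inj₂)
open import Relation.Binary.PropositionalEquality using (refl)
open import Relation.Binary.Construct.Closure.ReflexiveTransitive
  using (Star; ε; _◅_; _◅◅_; fold)

module _ {A : Set} where

  τ-Step : {X : Set} → KMor A X X → X → X → Set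
  τ-Step α x y = α x (inj₁ (τ , y))

  τ-Run : {X : Set} → KMor A X X → X → X → Set
  τ-Run α = Star (τ-Step α)

  data Weak {X : Set} (α : KMor A X X) : KMor A X X where
    silent      : ∀ {x y} → τ-Run α x y → Weak α x (inj₁ (τ , y))
    visible     : ∀ {σ x x₁ x₂ y} → τ-Run α x x₁ → α x₁ (inj₁ (σ , x₂)) →
                  τ-Run α x₂ y → Weak α x (inj₁ (σ , y))
    terminating : ∀ {x x₁} → τ-Run α x x₁ → α x₁ ✓ → Weak α x ✓

  Weak-τ⇒τ-Run : ∀ {X} {α : KMor A X X} {x y} →
                 Weak α x (inj₁ (τ , y)) → τ-Run α x y
  Weak-τ⇒τ-Run (silent p)      = p
  Weak-τ⇒τ-Run (visible p a q) = p ◅◅ (a ◅ q)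

  Weak-τ-Runˡ : ∀ {X} {α : KMor A X X} {x y e} →
                τ-Run α x y → Weak α y e → Weak α x e
  Weak-τ-Runˡ p (silent q)        = silent (p ◅◅ q)
  Weak-τ-Runˡ p (visible q a q′)  = visible (p ◅◅ q) a q′
  Weak-τ-Runˡ p (terminating q a) = terminating (p ◅◅ q) a

  Weak-τ-Runʳ : ∀ {X} {α : KMor A X X} {σ x y z} →
                Weak α x (inj₁ (σ , y)) → τ-Run α y z → Weak α x (inj₁ (σ , z))
  Weak-τ-Runʳ (silent p)       q = silent (p ◅◅ q)
  Weak-τ-Runʳ (visible p a p′) q = visible p a (p′ ◅◅ q)

  •-mono : {X Y Z : Set} {f f′ : KMor A X Y} {g g′ : KMor A Y Z} →
           f ≤K f′ → g ≤K g′ → g • f ≤K g′ • f′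
  •-mono f≤ g≤ x (inj₁ _) (y , inj₁ (a , b)) = y , inj₁ (f≤ _ _ a , g≤ _ _ b)
  •-mono f≤ g≤ x (inj₁ _) (y , inj₂ (a , b)) = y , inj₂ (f≤ _ _ a , g≤ _ _ b)
  •-mono f≤ g≤ x (inj₂ _) (inj₁ a)           = inj₁ (f≤ _ _ a)
  •-mono f≤ g≤ x (inj₂ _) (inj₂ (y , a , b)) = inj₂ (y , f≤ _ _ a , g≤ _ _ b)

  idK≤Weak : {X : Set} (α : KMor A X X) → idK ≤K Weak α
  idK≤Weak α x (inj₁ _) (refl , refl) = silent ε

  ≤Weak : {X : Set} (α : KMor A X X) → α ≤K Weak α
  ≤Weak α x (inj₁ _) a = visible ε a ε
  ≤Weak α x (inj₂ _) a = terminating ε a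

  Weak•Weak≤Weak : {X : Set} (α : KMor A X X) → Weak α • Weak α ≤K Weak α
  Weak•Weak≤Weak α x (inj₁ _) (y , inj₁ (a , b)) = Weak-τ-Runʳ a (Weak-τ⇒τ-Run b)
  Weak•Weak≤Weak α x (inj₁ _) (y , inj₂ (a , b)) = Weak-τ-Runˡ (Weak-τ⇒τ-Run a) b
  Weak•Weak≤Weak α x (inj₂ _) (inj₁ a)           = a
  Weak•Weak≤Weak α x (inj₂ _) (inj₂ (y , a , b)) = Weak-τ-Runˡ (Weak-τ⇒τ-Run a) b

  Weak-least : {X : Set} (α β : KMor A X X) →
               idK ≤K β → α ≤K β → β • β ≤K β → Weak α ≤K β
  Weak-least α β 1≤β α≤β β•β≤β = weak≤β
    where
    _∙_ : ∀ {x y e} → β x (inj₁ (τ , y)) → β y e → β x e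
    _∙_ {e = inj₁ _} b b′ = β•β≤β _ _ (_ , inj₂ (b , b′))
    _∙_ {e = inj₂ _} b b′ = β•β≤β _ _ (inj₂ (_ , b , b′))

    run≤β : ∀ {x y} → τ-Run α x y → β x (inj₁ (τ , y))
    run≤β = fold _ (λ a b → α≤β _ _ a ∙ b) (1≤β _ _ (refl , refl))

    weak≤β : Weak α ≤K β
    weak≤β x _ (silent p)        = run≤β p
    weak≤β x _ (visible p a q)   =
      β•β≤β _ _ (_ , inj₁ (run≤β p ∙ α≤β _ _ a , run≤β q))
    weak≤β x _ (terminating p a) = run≤β p ∙ α≤β _ _ a

  data Lift {X Y : Set} (r : BMor X Y) : F A X → F A Y → Set where
    step : ∀ {σ y z} → r y z → Lift r (inj₁ (σ , y)) (inj₁ (σ , z))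
    tick : Lift r ✓ ✓

  module _ {X Y : Set} (r : BMor X Y) where

    ♯•⁺ : ∀ {Z} {f : KMor A Z X} {x e} →
          ∃[ e′ ] (f x e′ × Lift r e′ e) → (r ♯ • f) x e
    ♯•⁺ (inj₁ (_ , y) , a , step ryz) = y , inj₁ (a , refl , ryz)
    ♯•⁺ (inj₂ _ , a , tick)           = inj₁ a

    ♯•⁻ : ∀ {Z} {f : KMor A Z X} {x e} →
          (r ♯ • f) x e → ∃[ e′ ] (f x e′ × Lift r e′ e)
    ♯•⁻ {e = inj₁ _} (y , inj₁ (a , _ , ryz))    = inj₁ (_ , y) , a , step ryz
    ♯•⁻ {e = inj₁ _} (y , inj₂ (a , refl , ryz)) = inj₁ (τ , y) , a , step ryz
    ♯•⁻ {e = inj₂ _} (inj₁ a)                    = ✓ , a , tick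

    •♯⁺ : ∀ {Z} {g : KMor A Y Z} {x e} →
          ∃[ w ] (r x w × g w e) → (g • r ♯) x e
    •♯⁺ {e = inj₁ _} (w , rxw , b) = w , inj₂ ((refl , rxw) , b)
    •♯⁺ {e = inj₂ _} (w , rxw , b) = inj₂ (w , (refl , rxw) , b)

    •♯⁻ : ∀ {Z} {g : KMor A Y Z} {x e} →
          (g • r ♯) x e → ∃[ w ] (r x w × g w e)
    •♯⁻ {e = inj₁ _} (w , inj₁ ((refl , rxw) , b)) = w , rxw , b
    •♯⁻ {e = inj₁ _} (w , inj₂ ((_ , rxw) , b))    = w , rxw , b
    •♯⁻ {e = inj₂ _} (inj₂ (w , (_ , rxw) , b))    = w , rxw , b

    -- Pointwise forms of r♯ • α ≤K β • r♯ and β • r♯ ≤K r♯ • α.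
    Square≤ : KMor A X X → KMor A Y Y → Set
    Square≤ α β = ∀ {x e′ e} → α x e′ → Lift r e′ e → ∃[ w ] (r x w × β w e)

    Square≥ : KMor A X X → KMor A Y Y → Set
    Square≥ α β = ∀ {x w e} → r x w → β w e → ∃[ e′ ] (α x e′ × Lift r e′ e)

    Square≤-Weak : ∀ {α β} → Square≤ α β → Square≤ (Weak α) (Weak β)
    Square≤-Weak {α} {β} sq = weak
      where
      run : ∀ {x y z} → τ-Run α x y → r y z → ∃[ w ] (r x w × τ-Run β w z)
      run ε       ryz = _ , ryz , ε
      run (a ◅ p) ryz with run p ryz
      ... | w′ , rw′ , q with sq a (step rw′)
      ...   | w , rw , b = w , rw , b ◅ q

      weak : Square≤ (Weak α) (Weak β)
      weak (silent p) (step ryz) with run p ryz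
      ... | w , rw , q = w , rw , silent q
      weak (visible p a q) (step ryz) with run q ryz
      ... | w₂ , rw₂ , q′ with sq a (step rw₂)
      ...   | w₁ , rw₁ , b with run p rw₁
      ...     | w , rw , p′ = w , rw , visible p′ b q′
      weak (terminating p a) tick with sq a tick
      ... | w₁ , rw₁ , b with run p rw₁
      ...   | w , rw , p′ = w , rw , terminating p′ b

    Square≥-Weak : ∀ {α β} → Square≥ α β → Square≥ (Weak α) (Weak β)
    Square≥-Weak {α} {β} sq = weak
      where
      run : ∀ {x y z} → r x y → τ-Run β y z → ∃[ w ] (τ-Run α x w × r w z)
      run rxy ε = _ , ε , rxy
      run rxy (b ◅ q) with sq rxy b
      ... | inj₁ _ , a , step rx′ with run rx′ q
      ...   | w , p , rw = w , a ◅ p , rw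

      weak : Square≥ (Weak α) (Weak β)
      weak rxy (silent q) with run rxy q
      ... | w , p , rw = inj₁ (τ , w) , silent p , step rw
      weak rxy (visible q b q′) with run rxy q
      ... | w₁ , p , rw₁ with sq rw₁ b
      ...   | inj₁ _ , a , step rw₂ with run rw₂ q′
      ...     | w , p′ , rw = inj₁ (_ , w) , visible p a p′ , step rw
      weak rxy (terminating q b) with run rxy q
      ... | w₁ , p , rw₁ with sq rw₁ b
      ...   | inj₂ _ , a , tick = ✓ , terminating p a , tick

    ♯-square≤-Weak : ∀ {α β} → r ♯ • α ≤K β • r ♯ → r ♯ • Weak α ≤K Weak β • r ♯
    ♯-square≤-Weak {α} {β} r♯•α≤β•r♯ x e c with ♯•⁻ c
    ... | _ , a , l = •♯⁺ (Square≤-Weak square a l)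
      where
      square : Square≤ α β
      square a l = •♯⁻ (r♯•α≤β•r♯ _ _ (♯•⁺ (_ , a , l)))

    ♯-square≥-Weak : ∀ {α β} → β • r ♯ ≤K r ♯ • α → Weak β • r ♯ ≤K r ♯ • Weak α
    ♯-square≥-Weak {α} {β} β•r♯≤r♯•α x e c with •♯⁻ c
    ... | _ , rxw , b = ♯•⁺ (Square≥-Weak square rxw b)
      where
      square : Square≥ α β
      square rxw b = ♯•⁻ (β•r♯≤r♯•α _ _ (•♯⁺ (_ , rxw , b)))

theorem5p13 : (A : Set) → OrderedSaturation A
theorem5p13 A = record
  { •-mono = •-mono
  ; _*     = Weak
  ; sat-1  = idK≤Weak
  ; sat-2  = ≤Weak
  ; sat-3  = Weak•Weak≤Weak
  ; sat-4  = Weak-least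
  ; sat-5≤ = λ r α β → ♯-square≤-Weak r
  ; sat-5≥ = λ r α β → ♯-square≥-Weak r
  }
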